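{- Let $T_k$ be a complete binary tree of depth $k\geq 1$. In Maker-Breaker Incidence, $Ls(T_k)=2^{k-1}$ and $Rs(T_k)=2^{k-1}-1$.
   Context: A complete binary tree of depth $k$ is a rooted tree in which every vertex at depth $j<k$ has exactly two children and every vertex at depth $k$ is a leaf. Maker-Breaker Incidence on a graph $G$: Left (Maker) and Right (Breaker) alternately claim a not yet claimed vertex until all vertices are claimed; the final score is the number of edges with both endpoints claimed by Left (Left maximizes, Right minimizes). $Ls(G)$ (resp. $Rs(G)$) is the final score under optimal play when Left (resp. Right) moves first. -}

module Defs where

open import Data.Nat using (ℕ; zero; suc; _+_; _*_; _∸_; _^_; _⊔_; _⊓_)
open import Data.Nat.Properties using (_≟_)
open import Data.Bool using (Bool; true; false; _∧_; if_then_else_)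
open import Data.List using (List; []; _∷_; length; filter; map; foldr; upTo; concatMap)
open import Data.Product using (_×_; _,_)
open import Relation.Nullary.Decidable using (does; ⌊_⌋)

-- A finite graph with vertex set {0, …, n-1} and a list of edges.
record Graph : Set where
  constructor mkGraph
  field
    size  : ℕ
    edges : List (ℕ × ℕ)
open Graph public

data Player : Set where
  Left Right : Player

other : Player → Player
other Left  = Right
other Right = Left

data Owner : Set where
  unclaimed byLeft byRight : Owner

owner : Player → Owner
owner Left  = byLeft
owner Right = byRight

Position : Set
Position = ℕ → Owner

start : Position
start _ = unclaimed

claim : Position → ℕ → Player → Position
claim s v p w = if does (w ≟ v) then owner p else s w

isLeft : Owner → Bool
isLeft byLeft = true
isLeft _      = false

isUnclaimed : Owner → Bool
isUnclaimed unclaimed = true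
isUnclaimed _         = false

score : Graph → Position → ℕ
score G s = length (filter (λ e → isBoth e) (edges G))
  where
  open import Data.Bool using (T)
  open import Relation.Nullary.Decidable using (Dec)
  open import Data.Bool.Properties using (T?)
  isBoth : (e : ℕ × ℕ) → Dec (T (isLeft (s (Data.Product.proj₁ e)) ∧ isLeft (s (Data.Product.proj₂ e))))
  isBoth (a , b) = T? (isLeft (s a) ∧ isLeft (s b))

unclaimedVertices : Graph → Position → List ℕ
unclaimedVertices G s = filter (λ v → Data.Bool.Properties.T? (isUnclaimed (s v))) (upTo (size G))
  where open import Data.Bool.Properties

-- The fuel argument bounds the number of remaining moves; with fuel = size G
-- from the empty position it is never exhausted before the game ends.
value : Graph → ℕ → Player → Position → ℕ
value G zero    p s = score G s
value G (suc f) p s with unclaimedVertices G s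
... | []     = score G s
... | v ∷ vs = foldr (combine p) (next v) (map next vs)
  where
  next : ℕ → ℕ
  next w = value G f (other p) (claim s w p)
  combine : Player → ℕ → ℕ → ℕ
  combine Left  = _⊔_
  combine Right = _⊓_

Ls : Graph → ℕ
Ls G = value G (size G) Left start

Rs : Graph → ℕ
Rs G = value G (size G) Right start

-- Complete binary tree of depth k in heap numbering: vertices 0 … 2^(k+1)-2,
-- root 0, the internal vertices i < 2^k - 1 have children 2i+1 and 2i+2.
completeBinaryTree : ℕ → Graph
completeBinaryTree k =
  mkGraph (2 ^ (suc k) ∸ 1)
          (concatMap (λ i → (i , 2 * i + 1) ∷ (i , 2 * i + 2) ∷ []) (upTo (2 ^ k ∸ 1)))

module Submission where

-- Number the vertices in heap order: the internal vertices are 0, …, 2m where 2m + 1 = 2^k − 1,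
-- vertex i has children 2i + 1 and 2i + 2, and the non-root vertices fall into sibling pairs.
-- The score is the sum over internal i of [i is Left] · (number of Left children of i).
-- A player who answers every move in a sibling pair with the other vertex of that pair ends with
-- at least one Left child per internal vertex if it is Left, at most one if it is Right. Since
-- the internal vertices other than the root are m sibling pairs, Left's pairing secures a score
-- ≥ [root is Left] + m and Right's pairing secures ≤ [root is Left] + m. The first player takes
-- the root and then pairs, the second pairs from the start; the two bounds meet at m + 1 when Left
-- starts and at m when Right starts.

open import Defs
open import Data.Bool using (true; false; T; _∧_)
open import Data.Bool.Properties using (T?)
open import Data.Unit using (⊤; tt)
open import Data.List using (List; []; _∷_; [_]; _++_; length; filter; map; upTo; concatMap)
open import Data.List.Membership.Propositional using (_∈_)
open import Data.List.Membership.Propositional.Properties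
  using (∈-filter⁺; ∈-filter⁻; ∈-upTo⁺; ∈-upTo⁻; ∈-length)
import Data.List.Relation.Unary.All as All
import Data.List.Relation.Unary.All.Properties as All
open import Data.List.Relation.Unary.Any using (Any; here; there)
import Data.List.Relation.Unary.Any as Any
import Data.List.Relation.Unary.Any.Properties as Any
open import Data.List.Properties
  using (upTo-∷ʳ; length-upTo; filter-++; filter-all; length-++; concatMap-++; ++-identityʳ; foldr-preservesᵒ; foldr-preservesᵇ)
open import Data.Nat using (ℕ; zero; suc; _+_; _*_; _∸_; _^_; _≤_; _<_; _⊔_; _⊓_; _≡ᵇ_; z≤n; s≤s)
open import Data.Nat.Properties
open import Data.Product using (Σ; Σ-syntax; _×_; _,_; proj₁; proj₂)
open import Data.Sum using (_⊎_; inj₁; inj₂; [_,_]′)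
open import Relation.Nullary using (Dec; yes; no; contradiction)
open import Data.List.Membership.DecPropositional _≟_ using (_∈?_)
open import Relation.Unary using (Decidable)
open import Relation.Binary.PropositionalEquality hiding ([_])
open import Function using (_∘′_)

claim-≡ : ∀ s v p → claim s v p v ≡ owner p
claim-≡ s v p with v ≡ᵇ v | ≡⇒≡ᵇ v v refl
... | true | _ = refl

claim-≢ : ∀ s v p {w} → w ≢ v → claim s v p w ≡ s w
claim-≢ s v p {w} w≢v with w ≡ᵇ v | ≡ᵇ⇒≡ w v
... | true  | w≡v = contradiction (w≡v _) w≢v
... | false | _   = refl

unclaimedBelow : Position → ℕ → List ℕ
unclaimedBelow s n = filter (λ v → T? (isUnclaimed (s v))) (upTo n)

length-filter-upTo-suc : ∀ {P : ℕ → Set} (P? : Decidable P) n →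
  length (filter P? (upTo (suc n))) ≡ length (filter P? (upTo n)) + length (filter P? [ n ])
length-filter-upTo-suc P? n = begin
  length (filter P? (upTo (suc n)))             ≡⟨ cong (length ∘′ filter P?) (sym (upTo-∷ʳ n)) ⟩
  length (filter P? (upTo n ++ [ n ])) ≡⟨ cong length (filter-++ P? (upTo n) [ n ]) ⟩
  length (filter P? (upTo n) ++ filter P? [ n ]) ≡⟨ length-++ (filter P? (upTo n)) ⟩
  length (filter P? (upTo n)) + length (filter P? [ n ]) ∎
  where open ≡-Reasoning

unclaimedCount : Owner → ℕ
unclaimedCount unclaimed = 1
unclaimedCount byLeft    = 0
unclaimedCount byRight   = 0

unclaimedCount-owner : ∀ p → unclaimedCount (owner p) ≡ 0
unclaimedCount-owner Left  = refl
unclaimedCount-owner Right = refl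

length-unclaimedBelow-suc : ∀ s n →
  length (unclaimedBelow s (suc n)) ≡ length (unclaimedBelow s n) + unclaimedCount (s n)
length-unclaimedBelow-suc s n =
  trans (length-filter-upTo-suc (λ v → T? (isUnclaimed (s v))) n) (cong (length (unclaimedBelow s n) +_) last)
  where
  last : length (filter (λ v → T? (isUnclaimed (s v))) [ n ]) ≡ unclaimedCount (s n)
  last with s n
  ... | unclaimed = refl
  ... | byLeft    = refl
  ... | byRight   = refl

claim-unclaimedBelow-≤ : ∀ s v p n → n ≤ v →
  length (unclaimedBelow (claim s v p) n) ≡ length (unclaimedBelow s n)
claim-unclaimedBelow-≤ s v p zero    _   = refl
claim-unclaimedBelow-≤ s v p (suc n) n<v = begin
  length (unclaimedBelow t (suc n))                   ≡⟨ length-unclaimedBelow-suc t n ⟩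
  length (unclaimedBelow t n) + unclaimedCount (t n)  ≡⟨ cong₂ _+_ (claim-unclaimedBelow-≤ s v p n (<⇒≤ n<v))
                                                                    (cong unclaimedCount (claim-≢ s v p (<⇒≢ n<v))) ⟩
  length (unclaimedBelow s n) + unclaimedCount (s n)  ≡⟨ length-unclaimedBelow-suc s n ⟨
  length (unclaimedBelow s (suc n))                   ∎
  where open ≡-Reasoning
        t = claim s v p

claim-unclaimedBelow-> : ∀ s v p n → v < n → s v ≡ unclaimed →
  length (unclaimedBelow s n) ≡ suc (length (unclaimedBelow (claim s v p) n))
claim-unclaimedBelow-> s v p (suc n) v<1+n sv with v ≟ n
... | yes refl = begin
  length (unclaimedBelow s (suc v))                   ≡⟨ length-unclaimedBelow-suc s v ⟩
  length (unclaimedBelow s v) + unclaimedCount (s v)  ≡⟨ cong₂ _+_ (claim-unclaimedBelow-≤ s v p v ≤-refl)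
                                                                    (cong unclaimedCount (sym sv)) ⟨
  length (unclaimedBelow t v) + 1                     ≡⟨ +-suc _ 0 ⟩
  suc (length (unclaimedBelow t v) + 0)               ≡⟨ cong (λ c → suc (length (unclaimedBelow t v) + c)) tv-claimed ⟨
  suc (length (unclaimedBelow t v) + unclaimedCount (t v)) ≡⟨ cong suc (length-unclaimedBelow-suc t v) ⟨
  suc (length (unclaimedBelow t (suc v)))             ∎
  where
  open ≡-Reasoning
  t = claim s v p
  tv-claimed : unclaimedCount (t v) ≡ 0
  tv-claimed = trans (cong unclaimedCount (claim-≡ s v p)) (unclaimedCount-owner p)
... | no v≢n = begin
  length (unclaimedBelow s (suc n))                   ≡⟨ length-unclaimedBelow-suc s n ⟩
  length (unclaimedBelow s n) + unclaimedCount (s n)  ≡⟨ cong₂ _+_ (claim-unclaimedBelow-> s v p n (≤∧≢⇒< (≤-pred v<1+n) v≢n) sv)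
                                                                    (cong unclaimedCount (sym (claim-≢ s v p (v≢n ∘′ sym)))) ⟩
  suc (length (unclaimedBelow t n) + unclaimedCount (t n)) ≡⟨ cong suc (length-unclaimedBelow-suc t n) ⟨
  suc (length (unclaimedBelow t (suc n)))             ∎
  where open ≡-Reasoning
        t = claim s v p

module _ {G : Graph} {s : Position} where

  ∈-unclaimedVertices⁺ : ∀ {v} → v < size G → s v ≡ unclaimed → v ∈ unclaimedVertices G s
  ∈-unclaimedVertices⁺ v<n sv =
    ∈-filter⁺ (λ w → T? (isUnclaimed (s w))) (∈-upTo⁺ v<n) (subst (T ∘′ isUnclaimed) (sym sv) tt)

  ∈-unclaimedVertices⁻ : ∀ {v} → v ∈ unclaimedVertices G s → v < size G × s v ≡ unclaimed
  ∈-unclaimedVertices⁻ {v} v∈ with ∈-filter⁻ (λ w → T? (isUnclaimed (s w))) {xs = upTo (size G)} v∈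
  ... | v∈upTo , isU = ∈-upTo⁻ v∈upTo , T-isUnclaimed (s v) isU
    where
    T-isUnclaimed : ∀ o → T (isUnclaimed o) → o ≡ unclaimed
    T-isUnclaimed unclaimed _ = refl

  length-unclaimedVertices-claim : ∀ {v} p → v ∈ unclaimedVertices G s →
    length (unclaimedVertices G s) ≡ suc (length (unclaimedVertices G (claim s v p)))
  length-unclaimedVertices-claim {v} p v∈ =
    let v<n , sv = ∈-unclaimedVertices⁻ v∈ in claim-unclaimedBelow-> s v p (size G) v<n sv

length-unclaimedVertices-start : ∀ G → length (unclaimedVertices G start) ≡ size G
length-unclaimedVertices-start G =
  trans (cong length (filter-all (λ w → T? (isUnclaimed (start w))) {upTo (size G)} (All.tabulate (λ _ → tt))))
        (length-upTo (size G))

Secures : Player → ℕ → ℕ → Set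
Secures Left  b x = b ≤ x
Secures Right b x = x ≤ b

secures-refl : ∀ p {a} → Secures p a a
secures-refl Left  = ≤-refl
secures-refl Right = ≤-refl

secures-trans : ∀ p {a b c} → Secures p a b → Secures p b c → Secures p a c
secures-trans Left  a≤b b≤c = ≤-trans a≤b b≤c
secures-trans Right b≤a c≤b = ≤-trans c≤b b≤a

secures-+ : ∀ p {a b c d} → Secures p a b → Secures p c d → Secures p (a + c) (b + d)
secures-+ Left  = +-mono-≤
secures-+ Right = +-mono-≤

secures-* : ∀ p a {c} → Secures p 1 c → Secures p a (a * c)
secures-* Left  a 1≤c = subst (_≤ a * _) (*-identityʳ a) (*-monoʳ-≤ a 1≤c)
secures-* Right a c≤1 = subst (a * _ ≤_) (*-identityʳ a) (*-monoʳ-≤ a c≤1)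

∈∷⇒head⊎Any-map : ∀ {P : ℕ → Set} {g : ℕ → ℕ} {v u us} → v ∈ u ∷ us → P (g v) →
  P (g u) ⊎ Any P (map g us)
∈∷⇒head⊎Any-map (here refl) pv = inj₁ pv
∈∷⇒head⊎Any-map (there v∈us) pv = inj₂ (Any.map⁺ (Any.map (λ { refl → pv }) v∈us))

value-own-move : ∀ {G f p s v b} → v ∈ unclaimedVertices G s →
  Secures p b (value G f (other p) (claim s v p)) → Secures p b (value G (suc f) p s)
value-own-move {G} {f} {Left} {s} {b = b} v∈ h with unclaimedVertices G s
... | u ∷ us = foldr-preservesᵒ {P = b ≤_} {f = _⊔_} (λ x y → [ m≤n⇒m≤n⊔o y , m≤n⇒m≤o⊔n x ]′) _ _
                 (∈∷⇒head⊎Any-map {g = λ w → value G f Right (claim s w Left)} v∈ h)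
value-own-move {G} {f} {Right} {s} {b = b} v∈ h with unclaimedVertices G s
... | u ∷ us = foldr-preservesᵒ {P = _≤ b} {f = _⊓_} (λ x y → [ m≤n⇒m⊓o≤n y , m≤n⇒o⊓m≤n x ]′) _ _
                 (∈∷⇒head⊎Any-map {g = λ w → value G f Left (claim s w Right)} v∈ h)

value-opponent-moves : ∀ {G f p s w b} → w ∈ unclaimedVertices G s →
  (∀ {v} → v ∈ unclaimedVertices G s → Secures p b (value G f p (claim s v (other p)))) →
  Secures p b (value G (suc f) (other p) s)
value-opponent-moves {G} {f} {Left} {s} {b = b} w∈ h with unclaimedVertices G s
... | u ∷ us = foldr-preservesᵇ {P = b ≤_} {f = _⊓_} ⊓-glb (h (here refl))
                 (All.map⁺ (All.tabulate (h ∘′ there)))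
value-opponent-moves {G} {f} {Right} {s} {b = b} w∈ h with unclaimedVertices G s
... | u ∷ us = foldr-preservesᵇ {P = _≤ b} {f = _⊔_} ⊔-lub (h (here refl))
                 (All.map⁺ (All.tabulate (h ∘′ there)))

FullyClaimed : Graph → Position → Set
FullyClaimed G s = ∀ {w} → w < size G → s w ≢ unclaimed

length-unclaimedVertices≡0⇒fullyClaimed : ∀ {G s} → length (unclaimedVertices G s) ≡ 0 → FullyClaimed G s
length-unclaimedVertices≡0⇒fullyClaimed {G} {s} len w<n sw =
  <⇒≢ (∈-length (∈-unclaimedVertices⁺ {G} {s} w<n sw)) (sym len)

length≡suc⇒member : ∀ (xs : List ℕ) {n} → length xs ≡ suc n → Σ ℕ (_∈ xs)
length≡suc⇒member (x ∷ _) _ = x , here refl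

owner-cases : ∀ p o → o ≡ unclaimed ⊎ o ≡ owner p ⊎ o ≡ owner (other p)
owner-cases Left  unclaimed = inj₁ refl
owner-cases Left  byLeft    = inj₂ (inj₁ refl)
owner-cases Left  byRight   = inj₂ (inj₂ refl)
owner-cases Right unclaimed = inj₁ refl
owner-cases Right byLeft    = inj₂ (inj₂ refl)
owner-cases Right byRight   = inj₂ (inj₁ refl)

owner≢unclaimed : ∀ p → owner p ≢ unclaimed
owner≢unclaimed Left  ()
owner≢unclaimed Right ()

owner≢owner-other : ∀ p → owner p ≢ owner (other p)
owner≢owner-other Left  ()
owner≢owner-other Right ()

record Pairing (G : Graph) : Set₁ where
  field
    _~_       : ℕ → ℕ → Set
    mate      : ℕ → ℕ
    ~⇒≡mate   : ∀ {a b} → a ~ b → b ≡ mate a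
    ~-sym     : ∀ {a b} → a ~ b → b ~ a
    ~-irrefl  : ∀ {a b} → a ~ b → a ≢ b
    ~-bounded : ∀ {a b} → a ~ b → b < size G

module PairingStrategy {G : Graph} (π : Pairing G) (p : Player) where
  open Pairing π

  Respects : Position → Set
  Respects s = ∀ {a b} → a ~ b → s a ≡ owner (other p) → s b ≡ owner p

  respects-start : Respects start
  respects-start _ sa = contradiction (sym sa) (owner≢unclaimed (other p))

  respects-claim-start : ∀ v → Respects (claim start v p)
  respects-claim-start v {a} _ ta with a ≟ v
  ... | yes refl = contradiction (trans (sym (claim-≡ start a p)) ta) (owner≢owner-other p)
  ... | no a≢v   = contradiction (trans (sym ta) (claim-≢ start v p a≢v)) (owner≢unclaimed (other p))

  module _ {s v} (r : Respects s) (sv : s v ≡ unclaimed) where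
    private t = claim s v (other p)

    respects-after-opponent : ∀ {a b} → a ~ b → t a ≡ owner (other p) →
      t b ≡ owner p ⊎ (a ≡ v × t b ≡ unclaimed)
    respects-after-opponent {a} {b} a~b ta with a ≟ v
    ... | no a≢v = inj₁ (trans (claim-≢ s v (other p) b≢v) sb)
      where
      sb = r a~b (trans (sym (claim-≢ s v (other p) a≢v)) ta)
      b≢v : b ≢ v
      b≢v refl = owner≢unclaimed p (trans (sym sb) sv)
    ... | yes refl with owner-cases p (s b)
    ...   | inj₁ sb        = inj₂ (refl , trans (claim-≢ s a (other p) (~-irrefl a~b ∘′ sym)) sb)
    ...   | inj₂ (inj₁ sb) = inj₁ (trans (claim-≢ s a (other p) (~-irrefl a~b ∘′ sym)) sb)
    ...   | inj₂ (inj₂ sb) = contradiction (trans (sym (r (~-sym a~b) sb)) sv) (owner≢unclaimed p)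

    respects-final : FullyClaimed G t → Respects t
    respects-final full a~b ta with respects-after-opponent a~b ta
    ... | inj₁ tb       = tb
    ... | inj₂ (_ , tb) = contradiction tb (full (~-bounded a~b))

    respects-response : ∀ {w} → (∀ {b} → v ~ b → t b ≡ unclaimed → b ≡ w) → Respects (claim t w p)
    respects-response {w} only {a} {b} a~b ta with b ≟ w | a ≟ w
    ... | yes refl | _      = claim-≡ t b p
    ... | no _     | yes refl = contradiction (trans (sym (claim-≡ t a p)) ta) (owner≢owner-other p)
    ... | no b≢w   | no a≢w with respects-after-opponent a~b (trans (sym (claim-≢ t w p a≢w)) ta)
    ...   | inj₁ tb             = trans (claim-≢ t w p b≢w) tb
    ...   | inj₂ (refl , tb)    = contradiction (only a~b tb) b≢w

  reply : ∀ {t v n} → length (unclaimedVertices G t) ≡ suc n →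
    Σ[ w ∈ ℕ ] w ∈ unclaimedVertices G t × (∀ {b} → v ~ b → t b ≡ unclaimed → b ≡ w)
  reply {t} {v} len with mate v ∈? unclaimedVertices G t
  ... | yes m∈ = mate v , m∈ , λ v~b _ → ~⇒≡mate v~b
  ... | no m∉  = let w , w∈ = length≡suc⇒member (unclaimedVertices G t) len in w , w∈ , λ v~b tb →
    contradiction (subst (_∈ _) (~⇒≡mate v~b) (∈-unclaimedVertices⁺ {G} {t} (~-bounded v~b) tb)) m∉

  -- Q records what the rest of the play cannot change, such as who owns the root.
  module _ (B : ℕ) (Q : Position → Set)
           (Q-claim : ∀ s v q → Q s → s v ≡ unclaimed → Q (claim s v q))
           (final : ∀ {s} → Q s → Respects s → FullyClaimed G s → Secures p B (score G s)) where
    mutual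
      pairing-secures : ∀ f {s} → length (unclaimedVertices G s) ≡ f → Q s → Respects s →
        Secures p B (value G f (other p) s)
      pairing-secures zero {s} len q r = final q r (length-unclaimedVertices≡0⇒fullyClaimed {G} {s} len)
      pairing-secures (suc f) {s} len q r =
        value-opponent-moves {G} {f} {p} {s} (proj₂ (length≡suc⇒member (unclaimedVertices G s) len)) λ v∈ →
          pairing-responds f v∈
            (suc-injective (trans (sym (length-unclaimedVertices-claim {G} {s} (other p) v∈)) len)) q r

      pairing-responds : ∀ f {s v} → v ∈ unclaimedVertices G s →
        length (unclaimedVertices G (claim s v (other p))) ≡ f → Q s → Respects s →
        Secures p B (value G f p (claim s v (other p)))
      pairing-responds zero {s} {v} v∈ len q r =
        final (Q-claim s v (other p) q sv) (respects-final r sv full) full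
        where
        sv = proj₂ (∈-unclaimedVertices⁻ {G} {s} v∈)
        full = length-unclaimedVertices≡0⇒fullyClaimed {G} {claim s v (other p)} len
      pairing-responds (suc f) {s} {v} v∈ len q r with reply {claim s v (other p)} {v} len
      ... | w , w∈ , only = value-own-move {G} {f} {p} {t} w∈
        (pairing-secures f (suc-injective (trans (sym (length-unclaimedVertices-claim {G} {t} p w∈)) len))
          (Q-claim t w p (Q-claim s v (other p) q sv) (proj₂ (∈-unclaimedVertices⁻ {G} {t} w∈)))
          (respects-response r sv only))
        where
        t = claim s v (other p)
        sv = proj₂ (∈-unclaimedVertices⁻ {G} {s} v∈)

score-++ : ∀ N xs ys s → score (mkGraph N (xs ++ ys)) s ≡ score (mkGraph N xs) s + score (mkGraph N ys) s
score-++ N xs ys s = trans (cong length (filter-++ bothLeft? xs ys)) (length-++ (filter bothLeft? xs))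
  where
  bothLeft? : (e : ℕ × ℕ) → Dec (T (isLeft (s (proj₁ e)) ∧ isLeft (s (proj₂ e))))
  bothLeft? e = T? (isLeft (s (proj₁ e)) ∧ isLeft (s (proj₂ e)))

leftIndicator : Owner → ℕ
leftIndicator byLeft    = 1
leftIndicator unclaimed = 0
leftIndicator byRight   = 0

score-edge : ∀ N a b s → score (mkGraph N [ (a , b) ]) s ≡ leftIndicator (s a) * leftIndicator (s b)
score-edge N a b s with s a | s b
... | unclaimed | _         = refl
... | byRight   | _         = refl
... | byLeft    | unclaimed = refl
... | byLeft    | byLeft    = refl
... | byLeft    | byRight   = refl

sumBelow : ℕ → (ℕ → ℕ) → ℕ
sumBelow zero    h = 0
sumBelow (suc n) h = sumBelow n h + h n

score-concatMap-upTo : ∀ N (g : ℕ → List (ℕ × ℕ)) n s →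
  score (mkGraph N (concatMap g (upTo n))) s ≡ sumBelow n (λ i → score (mkGraph N (g i)) s)
score-concatMap-upTo N g zero    s = refl
score-concatMap-upTo N g (suc n) s = begin
  score (mkGraph N (concatMap g (upTo (suc n)))) s
    ≡⟨ cong (λ vs → score (mkGraph N (concatMap g vs)) s) (sym (upTo-∷ʳ n)) ⟩
  score (mkGraph N (concatMap g (upTo n ++ [ n ]))) s
    ≡⟨ cong (λ es → score (mkGraph N es) s) (concatMap-++ g (upTo n) [ n ]) ⟩
  score (mkGraph N (concatMap g (upTo n) ++ (g n ++ []))) s
    ≡⟨ score-++ N (concatMap g (upTo n)) (g n ++ []) s ⟩
  score (mkGraph N (concatMap g (upTo n))) s + score (mkGraph N (g n ++ [])) s
    ≡⟨ cong₂ _+_ (score-concatMap-upTo N g n s) (cong (λ es → score (mkGraph N es) s) (++-identityʳ (g n))) ⟩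
  sumBelow n (λ i → score (mkGraph N (g i)) s) + score (mkGraph N (g n)) s ∎
  where open ≡-Reasoning

secures-sumBelow : ∀ p n {f g : ℕ → ℕ} → (∀ i → i < n → Secures p (f i) (g i)) →
  Secures p (sumBelow n f) (sumBelow n g)
secures-sumBelow p zero    _ = secures-refl p
secures-sumBelow p (suc n) h =
  secures-+ p (secures-sumBelow p n (λ i i<n → h i (m<n⇒m<1+n i<n))) (h n (n<1+n n))

sumBelow-one : ∀ n → sumBelow n (λ _ → 1) ≡ n
sumBelow-one zero    = refl
sumBelow-one (suc n) = trans (cong (_+ 1) (sumBelow-one n)) (+-comm n 1)

sumBelow-odd : ∀ h m → sumBelow (2 * m + 1) h ≡ h 0 + sumBelow m (λ j → h (2 * j + 1) + h (2 * j + 2))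
sumBelow-odd h zero    = sym (+-identityʳ (h 0))
sumBelow-odd h (suc m) = begin
  sumBelow (2 * suc m + 1) h
    ≡⟨ cong (λ n → sumBelow (n + 1) h) (*-suc 2 m) ⟩
  (sumBelow (2 * m + 1) h + h (2 * m + 1)) + h (suc (2 * m + 1))
    ≡⟨ cong₂ (λ x n → (x + h (2 * m + 1)) + h n) (sumBelow-odd h m) (sym (+-suc (2 * m) 1)) ⟩
  (h 0 + sumBelow m pair + h (2 * m + 1)) + h (2 * m + 2)
    ≡⟨ trans (+-assoc (h 0 + sumBelow m pair) _ _) (+-assoc (h 0) (sumBelow m pair) _) ⟩
  h 0 + sumBelow (suc m) pair ∎
  where
  open ≡-Reasoning
  pair = λ j → h (2 * j + 1) + h (2 * j + 2)

children : ℕ → List (ℕ × ℕ)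
children i = (i , 2 * i + 1) ∷ (i , 2 * i + 2) ∷ []

-- The full binary tree in heap numbering with internal vertices 0, …, 2m;
-- completeBinaryTree k is heapTree m for 2m + 1 = 2^k − 1.
heapTree : ℕ → Graph
heapTree m = mkGraph (2 * (2 * m + 1) + 1) (concatMap children (upTo (2 * m + 1)))

leftChildren : Position → ℕ → ℕ
leftChildren s i = leftIndicator (s (2 * i + 1)) + leftIndicator (s (2 * i + 2))

score-children : ∀ N i s → score (mkGraph N (children i)) s ≡ leftIndicator (s i) * leftChildren s i
score-children N i s = begin
  score (mkGraph N (children i)) s
    ≡⟨ score-++ N [ (i , 2 * i + 1) ] [ (i , 2 * i + 2) ] s ⟩
  score (mkGraph N [ (i , 2 * i + 1) ]) s + score (mkGraph N [ (i , 2 * i + 2) ]) s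
    ≡⟨ cong₂ _+_ (score-edge N i (2 * i + 1) s) (score-edge N i (2 * i + 2) s) ⟩
  leftIndicator (s i) * leftIndicator (s (2 * i + 1)) + leftIndicator (s i) * leftIndicator (s (2 * i + 2))
    ≡⟨ *-distribˡ-+ (leftIndicator (s i)) _ _ ⟨
  leftIndicator (s i) * leftChildren s i ∎
  where open ≡-Reasoning

heapTree-secures : ∀ p m s → (∀ i → i < 2 * m + 1 → Secures p 1 (leftChildren s i)) →
  Secures p (leftIndicator (s 0) + m) (score (heapTree m) s)
heapTree-secures p m s h = secures-trans p step₁ (subst (Secures p _) (sym (score-concatMap-upTo N children M s)) step₂)
  where
  M = 2 * m + 1
  N = 2 * M + 1
  step₁ : Secures p (leftIndicator (s 0) + m) (sumBelow M (leftIndicator ∘′ s))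
  step₁ = subst (Secures p _) (sym (sumBelow-odd (leftIndicator ∘′ s) m))
    (secures-+ p (secures-refl p)
      (subst (λ b → Secures p b (sumBelow m (leftChildren s))) (sumBelow-one m)
        (secures-sumBelow p m λ j j<m → h j (≤-trans j<m (≤-trans (m≤n*m m 2) (m≤m+n (2 * m) 1))))))
  step₂ : Secures p (sumBelow M (leftIndicator ∘′ s)) (sumBelow M (λ i → score (mkGraph N (children i)) s))
  step₂ = secures-sumBelow p M λ i i<M →
    subst (Secures p _) (sym (score-children N i s)) (secures-* p (leftIndicator (s i)) (h i i<M))

data Siblings (M : ℕ) : ℕ → ℕ → Set where
  left→right : ∀ {i} → i < M → Siblings M (2 * i + 1) (2 * i + 2)
  right→left : ∀ {i} → i < M → Siblings M (2 * i + 2) (2 * i + 1)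

-- mate 0 is junk: the root has no sibling.
mate : ℕ → ℕ
mate 0                   = 0
mate 1                   = 2
mate 2                   = 1
mate (suc (suc (suc v))) = 2 + mate (suc v)

mate-2+ : ∀ v → 1 ≤ v → mate (2 + v) ≡ 2 + mate v
mate-2+ (suc v) _ = refl

2*[1+i]+j≡2+[2*i+j] : ∀ i j → 2 * suc i + j ≡ 2 + (2 * i + j)
2*[1+i]+j≡2+[2*i+j] i j = cong (_+ j) (*-suc 2 i)

mate-odd : ∀ i → mate (2 * i + 1) ≡ 2 * i + 2
mate-odd zero    = refl
mate-odd (suc i) = begin
  mate (2 * suc i + 1)      ≡⟨ cong mate (2*[1+i]+j≡2+[2*i+j] i 1) ⟩
  mate (2 + (2 * i + 1))    ≡⟨ mate-2+ (2 * i + 1) (m≤n+m 1 (2 * i)) ⟩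
  2 + mate (2 * i + 1)      ≡⟨ cong (2 +_) (mate-odd i) ⟩
  2 + (2 * i + 2)           ≡⟨ 2*[1+i]+j≡2+[2*i+j] i 2 ⟨
  2 * suc i + 2             ∎
  where open ≡-Reasoning

mate-even : ∀ i → mate (2 * i + 2) ≡ 2 * i + 1
mate-even zero    = refl
mate-even (suc i) = begin
  mate (2 * suc i + 2)      ≡⟨ cong mate (2*[1+i]+j≡2+[2*i+j] i 2) ⟩
  mate (2 + (2 * i + 2))    ≡⟨ mate-2+ (2 * i + 2) (≤-trans (s≤s z≤n) (m≤n+m 2 (2 * i))) ⟩
  2 + mate (2 * i + 2)      ≡⟨ cong (2 +_) (mate-even i) ⟩
  2 + (2 * i + 1)           ≡⟨ 2*[1+i]+j≡2+[2*i+j] i 1 ⟨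
  2 * suc i + 1             ∎
  where open ≡-Reasoning

2*i+2<2*M+1 : ∀ {i M} → i < M → 2 * i + 2 < 2 * M + 1
2*i+2<2*M+1 {i} {M} i<M = subst (_≤ 2 * M + 1) 2*[1+i]+1≡1+[2*i+2] (+-monoˡ-≤ 1 (*-monoʳ-≤ 2 i<M))
  where
  2*[1+i]+1≡1+[2*i+2] : 2 * suc i + 1 ≡ suc (2 * i + 2)
  2*[1+i]+1≡1+[2*i+2] = trans (2*[1+i]+j≡2+[2*i+j] i 1) (cong suc (sym (+-suc (2 * i) 1)))

siblingPairing : ∀ m → Pairing (heapTree m)
siblingPairing m = record
  { _~_       = Siblings (2 * m + 1)
  ; mate      = mate
  ; ~⇒≡mate   = λ { (left→right {i} _) → sym (mate-odd i) ; (right→left {i} _) → sym (mate-even i) }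
  ; ~-sym     = λ { (left→right i<M) → right→left i<M ; (right→left i<M) → left→right i<M }
  ; ~-irrefl  = λ { (left→right {i} _) → odd≢even i ; (right→left {i} _) → odd≢even i ∘′ sym }
  ; ~-bounded = λ { (left→right i<M) → 2*i+2<2*M+1 i<M
                  ; (right→left {i} i<M) → <-trans (+-monoʳ-< (2 * i) (n<1+n 1)) (2*i+2<2*M+1 i<M) }
  }
  where
  odd≢even : ∀ i → 2 * i + 1 ≢ 2 * i + 2
  odd≢even i eq = contradiction (+-cancelˡ-≡ (2 * i) 1 2 eq) λ ()

leftIndicator≤1 : ∀ o → leftIndicator o ≤ 1
leftIndicator≤1 byLeft    = ≤-refl
leftIndicator≤1 unclaimed = z≤n
leftIndicator≤1 byRight   = z≤n

secures-leftIndicator : ∀ p o → Secures p (leftIndicator (owner (other p))) (leftIndicator o)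
secures-leftIndicator Left  o = z≤n
secures-leftIndicator Right o = leftIndicator≤1 o

siblings-secure : ∀ p x y → (x ≡ owner (other p) → y ≡ owner p) → x ≢ unclaimed →
  Secures p 1 (leftIndicator x + leftIndicator y)
siblings-secure Left  byLeft    y _ _  = s≤s z≤n
siblings-secure Left  byRight   y r _  = subst (λ o → 1 ≤ leftIndicator o) (sym (r refl)) ≤-refl
siblings-secure Left  unclaimed y _ x≢ = contradiction refl x≢
siblings-secure Right byLeft    y r _  = subst (λ o → 1 + leftIndicator o ≤ 1) (sym (r refl)) ≤-refl
siblings-secure Right byRight   y _ _  = leftIndicator≤1 y
siblings-secure Right unclaimed y _ x≢ = contradiction refl x≢

claim-unclaimed-≢ : ∀ s v q {w} → s w ≢ unclaimed → s v ≡ unclaimed → claim s v q w ≡ s w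
claim-unclaimed-≢ s v q sw sv = claim-≢ s v q λ { refl → sw sv }

module _ (m : ℕ) where
  private
    G = heapTree m
    M = 2 * m + 1
  open Pairing (siblingPairing m) using (~-bounded)

  size≡suc : size G ≡ suc (2 * M)
  size≡suc = +-comm (2 * M) 1

  module _ (p : Player) where
    open PairingStrategy (siblingPairing m) p

    respects-secures : ∀ {s} → Respects s → FullyClaimed G s →
      Secures p (leftIndicator (s 0) + m) (score G s)
    respects-secures {s} r full = heapTree-secures p m s λ i i<M →
      siblings-secure p _ _ (r (left→right i<M)) (full (~-bounded (right→left i<M)))

    first-mover-secures : Secures p (leftIndicator (owner p) + m) (value G (size G) p start)
    first-mover-secures =
      subst (λ n → Secures p (leftIndicator (owner p) + m) (value G n p start)) (sym size≡suc)
      (value-own-move {G} {2 * M} {p} {start} root∈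
        (pairing-secures (leftIndicator (owner p) + m) Root Root-claim final
          (2 * M) len (claim-≡ start 0 p) (respects-claim-start 0)))
      where
      Root : Position → Set
      Root s = s 0 ≡ owner p
      Root-claim : ∀ s v q → Root s → s v ≡ unclaimed → Root (claim s v q)
      Root-claim s v q root sv =
        trans (claim-unclaimed-≢ s v q (λ s0 → owner≢unclaimed p (trans (sym root) s0)) sv) root
      final : ∀ {s} → Root s → Respects s → FullyClaimed G s →
        Secures p (leftIndicator (owner p) + m) (score G s)
      final root r full = subst (λ o → Secures p (leftIndicator o + m) _) root (respects-secures r full)
      root∈ : 0 ∈ unclaimedVertices G start
      root∈ = ∈-unclaimedVertices⁺ {G} {start} (subst (0 <_) (sym size≡suc) (s≤s z≤n)) refl
      len : length (unclaimedVertices G (claim start 0 p)) ≡ 2 * M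
      len = suc-injective (trans (sym (length-unclaimedVertices-claim {G} {start} p root∈))
                                 (trans (length-unclaimedVertices-start G) size≡suc))

    second-mover-secures : Secures p (leftIndicator (owner (other p)) + m) (value G (size G) (other p) start)
    second-mover-secures =
      pairing-secures (leftIndicator (owner (other p)) + m) (λ _ → ⊤) (λ _ _ _ _ _ → tt) final
        (size G) (length-unclaimedVertices-start G) tt respects-start
      where
      final : ∀ {s} → ⊤ → Respects s → FullyClaimed G s →
        Secures p (leftIndicator (owner (other p)) + m) (score G s)
      final {s} _ r full =
        secures-trans p (secures-+ p (secures-leftIndicator p (s 0)) (secures-refl p)) (respects-secures r full)

  Ls-heapTree : Ls G ≡ suc m
  Ls-heapTree = ≤-antisym (second-mover-secures Right) (first-mover-secures Left)

  Rs-heapTree : Rs G ≡ m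
  Rs-heapTree = ≤-antisym (first-mover-secures Right) (second-mover-secures Left)

2*n∸1 : ∀ n → 1 ≤ n → 2 * n ∸ 1 ≡ 2 * (n ∸ 1) + 1
2*n∸1 (suc n) _ = trans (cong (_∸ 1) (*-suc 2 n)) (+-comm 1 (2 * n))

2^[1+k]∸1 : ∀ k → 2 ^ suc k ∸ 1 ≡ 2 * (2 ^ k ∸ 1) + 1
2^[1+k]∸1 k = 2*n∸1 (2 ^ k) (m^n>0 2 k)

completeBinaryTree≡heapTree : ∀ k → completeBinaryTree (suc k) ≡ heapTree (2 ^ k ∸ 1)
completeBinaryTree≡heapTree k =
  cong₂ mkGraph (trans (2^[1+k]∸1 (suc k)) (cong (λ n → 2 * n + 1) (2^[1+k]∸1 k)))
                (cong (concatMap children ∘′ upTo) (2^[1+k]∸1 k))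

mainTheorem14 : (k : ℕ) → 1 ≤ k →
    (Ls (completeBinaryTree k) ≡ 2 ^ (k ∸ 1)) × (Rs (completeBinaryTree k) ≡ 2 ^ (k ∸ 1) ∸ 1)
mainTheorem14 zero    ()
mainTheorem14 (suc k) _ =
  trans (cong Ls (completeBinaryTree≡heapTree k)) (trans (Ls-heapTree m) (suc-pred (2 ^ k) {{m^n≢0 2 k}})) ,
  trans (cong Rs (completeBinaryTree≡heapTree k)) (Rs-heapTree m)
  where m = 2 ^ k ∸ 1
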